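{- Let $a,d\geq 1$ be integers and let $n\geq d+2a$. Then \[ q_d^{(a)}(n)\geq q_{\lceil d/a\rceil}^{(1)}\!\left(\lceil n/a\rceil\right). \]
   Context: For positive integers $a,d,n$, $q_d^{(a)}(n)$ denotes the number of partitions of $n$ in which every part is at least $a$ and any two parts differ by at least $d$. -}

module Defs where

open import Data.Nat using (ℕ; zero; suc; _+_; _∸_; _≤_; _≤?_; NonZero)
open import Data.Nat.DivMod using (_/_)
open import Data.List using (List; []; _∷_; map; _++_; length; filter; downFrom)
open import Data.List.Relation.Unary.All using (All; all?)
open import Data.Bool using (Bool; true; false; _∧_)
open import Relation.Nullary using (Dec; yes; no; does)
open import Relation.Unary using (Decidable)
open import Data.Product using (_×_)
open import Relation.Binary.PropositionalEquality using (_≡_)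
import Data.Nat as ℕ
open import Data.Nat.ListAction using (sum)

sublists : {A : Set} → List A → List (List A)
sublists [] = [] ∷ []
sublists (x ∷ xs) = map (x ∷_) (sublists xs) ++ sublists xs

GapsAtLeast : ℕ → List ℕ → Set
GapsAtLeast d [] = Data.Unit.⊤ where import Data.Unit
GapsAtLeast d (x ∷ []) = Data.Unit.⊤ where import Data.Unit
GapsAtLeast d (x ∷ y ∷ ys) = (d + y ≤ x) × GapsAtLeast d (y ∷ ys)

gapsAtLeast? : (d : ℕ) → (xs : List ℕ) → Dec (GapsAtLeast d xs)
gapsAtLeast? d [] = yes _
gapsAtLeast? d (x ∷ []) = yes _
gapsAtLeast? d (x ∷ y ∷ ys) with d + y ≤? x | gapsAtLeast? d (y ∷ ys)
... | yes p | yes q = yes (p Data.Product., q)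
... | no ¬p | _ = no (λ r → ¬p (Data.Product.proj₁ r))
... | yes _ | no ¬q = no (λ r → ¬q (Data.Product.proj₂ r))

IsDiffPartition : (a d n : ℕ) → List ℕ → Set
IsDiffPartition a d n ps = (sum ps ≡ n) × All (a ≤_) ps × GapsAtLeast d ps

isDiffPartition? : (a d n : ℕ) → Decidable (IsDiffPartition a d n)
isDiffPartition? a d n ps with sum ps ℕ.≟ n | all? (a ≤?_) ps | gapsAtLeast? d ps
... | yes p | yes q | yes r = yes (p Data.Product., q Data.Product., r)
... | no ¬p | _ | _ = no (λ z → ¬p (Data.Product.proj₁ z))
... | yes _ | no ¬q | _ = no (λ z → ¬q (Data.Product.proj₁ (Data.Product.proj₂ z)))
... | yes _ | yes _ | no ¬r = no (λ z → ¬r (Data.Product.proj₂ (Data.Product.proj₂ z)))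

-- q_d^{(a)}(n) for d ≥ 1: since d ≥ 1 the parts are distinct, so every such
-- partition is a strictly decreasing list of numbers in {1,…,n}, i.e. a
-- sublist of downFrom-list [n, n-1, …, 1]; we count those that qualify.
-- (Part 0 never occurs since parts are positive; a ≥ 1 in all uses.)
positives : ℕ → List ℕ
positives n = map suc (downFrom n)

q : (a d n : ℕ) → ℕ
q a d n = length (filter (isDiffPartition? a d n) (sublists (positives n)))

⌈_/_⌉ : (m k : ℕ) → .{{NonZero k}} → ℕ
⌈ m / k ⌉ = (m + k ∸ 1) / k

-- Scaling a partition of m = ⌈n/a⌉ with gaps ≥ e = ⌈d/a⌉ by a gives a partition of
-- a m = n + r (0 ≤ r < a) with parts ≥ a and gaps ≥ a e ≥ d; subtracting r from the
-- smallest part yields a partition counted by q_d^{(a)}(n), unless that part is 1 and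
-- r > 0. In that case the part 1 is dropped and a − r is added to the largest part,
-- except that (m − 1, 1) goes to (n − a, a) rather than to (n), the image of (m); this
-- is where n ≥ d + 2a is used. The map is injective: for r > 0, the smallest part of
-- an image is a multiple of a exactly when a part 1 was dropped.
module Submission where

open import Defs
open import Data.Nat using (ℕ; zero; suc; _+_; _*_; _∸_; _≤_; _<_; _≥_; z≤n; s≤s; s≤s⁻¹; z<s; NonZero; _≤?_; >-nonZero; >-nonZero⁻¹)
open import Data.Nat.Properties
open import Data.Nat.DivMod using (_/_; _%_; m≡m%n+[m/n]*n; m%n<n; m/n*n≤m)
open import Data.Nat.Divisibility using (_∣_; _∤_; ∣⇒≤; ∣m+n∣m⇒∣n; m∣m*n; ∣-refl; _∣0)
open import Data.Nat.ListAction using (sum)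
open import Data.List using (List; []; _∷_; map; _++_; length; filter)
open import Data.List.Properties using (length-++; ∷-injectiveˡ; ∷-injectiveʳ)
open import Data.List.Relation.Unary.All as All using (All; []; _∷_)
open import Data.List.Relation.Unary.All.Properties using (All¬⇒¬Any)
open import Data.List.Relation.Unary.Any using (here; there)
open import Data.List.Relation.Unary.Unique.Propositional using (Unique; []; _∷_)
import Data.List.Relation.Unary.Unique.Propositional.Properties as Unique
open import Data.List.Membership.Propositional using (_∈_)
open import Data.List.Membership.Propositional.Properties
open import Data.List.Relation.Binary.Subset.Propositional using (_⊆_)
open import Data.Product using (_×_; _,_; proj₁; proj₂)
open import Data.Sum using (inj₁; inj₂)
open import Data.Unit using (tt)
open import Function using (_∘_)
open import Relation.Nullary using (¬_; yes; no; contradiction)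
open import Relation.Binary.PropositionalEquality
open import Data.Nat.Solver using (module +-*-Solver)
open +-*-Solver using (solve; _:+_; _:=_)

∈-sublists⇒⊆ : ∀ {A : Set} {xs ys : List A} → ys ∈ sublists xs → ys ⊆ xs
∈-sublists⇒⊆ {xs = []} (here refl) ()
∈-sublists⇒⊆ {xs = x ∷ xs} ys∈ v∈ with ∈-++⁻ (map (x ∷_) (sublists xs)) ys∈
... | inj₂ ys∈′ = there (∈-sublists⇒⊆ ys∈′ v∈)
... | inj₁ x∷ys∈ with ∈-map⁻ (x ∷_) x∷ys∈ | v∈
...   | _ , _ , refl | here refl = here refl
...   | _ , ys∈′ , refl | there v∈′ = there (∈-sublists⇒⊆ ys∈′ v∈′)

[]∈sublists : ∀ {A : Set} (xs : List A) → [] ∈ sublists xs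
[]∈sublists [] = here refl
[]∈sublists (x ∷ xs) = ∈-++⁺ʳ (map (x ∷_) (sublists xs)) ([]∈sublists xs)

sublists-unique : ∀ {A : Set} {xs : List A} → Unique xs → Unique (sublists xs)
sublists-unique {xs = []} [] = [] ∷ []
sublists-unique {xs = x ∷ xs} (x∉xs ∷ xs!) =
  Unique.++⁺ (Unique.map⁺ ∷-injectiveʳ (sublists-unique xs!)) (sublists-unique xs!) disjoint
  where
  disjoint : ∀ {ys} → ¬ (ys ∈ map (x ∷_) (sublists xs) × ys ∈ sublists xs)
  disjoint (x∷zs∈ , ys∈) with ∈-map⁻ (x ∷_) x∷zs∈
  ... | _ , _ , refl = All¬⇒¬Any x∉xs (∈-sublists⇒⊆ ys∈ (here refl))

∈-positives⇒≤ : ∀ {n y} → y ∈ positives n → y ≤ n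
∈-positives⇒≤ {suc n} (here refl) = ≤-refl
∈-positives⇒≤ {suc n} (there y∈) = m≤n⇒m≤1+n (∈-positives⇒≤ y∈)

positives-unique : ∀ n → Unique (positives n)
positives-unique zero = []
positives-unique (suc n) =
  All.tabulate (λ y∈ → >⇒≢ (s≤s (∈-positives⇒≤ y∈))) ∷ positives-unique n

GapsAtLeast-mono : ∀ {d d′} → d′ ≤ d → ∀ ps → GapsAtLeast d ps → GapsAtLeast d′ ps
GapsAtLeast-mono d′≤d [] gaps = gaps
GapsAtLeast-mono d′≤d (x ∷ []) gaps = gaps
GapsAtLeast-mono d′≤d (x ∷ y ∷ ys) (gap , gaps) =
  ≤-trans (+-monoˡ-≤ y d′≤d) gap , GapsAtLeast-mono d′≤d (y ∷ ys) gaps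

GapsAtLeast-tail : ∀ {d x ys} → GapsAtLeast d (x ∷ ys) → GapsAtLeast d ys
GapsAtLeast-tail {ys = []} _ = tt
GapsAtLeast-tail {ys = y ∷ ys} (_ , gaps) = gaps

GapsAtLeast1⇒All<head : ∀ {x ys} → GapsAtLeast 1 (x ∷ ys) → All (_< x) ys
GapsAtLeast1⇒All<head {ys = []} _ = []
GapsAtLeast1⇒All<head {ys = y ∷ ys} (y<x , gaps) =
  y<x ∷ All.map (λ z<y → <-trans z<y y<x) (GapsAtLeast1⇒All<head gaps)

decreasing⇒∈-sublists-positives : ∀ n ps → GapsAtLeast 1 ps → All (1 ≤_) ps → All (_≤ n) ps →
  ps ∈ sublists (positives n)
decreasing⇒∈-sublists-positives n [] _ _ _ = []∈sublists (positives n)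
decreasing⇒∈-sublists-positives zero (p ∷ ps) _ (1≤p ∷ _) (p≤0 ∷ _) = contradiction (≤-trans 1≤p p≤0) λ ()
decreasing⇒∈-sublists-positives (suc n) (p ∷ ps) gaps (1≤p ∷ 1≤ps) (p≤1+n ∷ _) with m≤n⇒m<n∨m≡n p≤1+n
... | inj₂ refl = ∈-++⁺ˡ (∈-map⁺ (suc n ∷_)
      (decreasing⇒∈-sublists-positives n ps (GapsAtLeast-tail gaps) 1≤ps
        (All.map s≤s⁻¹ (GapsAtLeast1⇒All<head gaps))))
... | inj₁ (s≤s p≤n) = ∈-++⁺ʳ (map (suc n ∷_) (sublists (positives n)))
      (decreasing⇒∈-sublists-positives n (p ∷ ps) gaps (1≤p ∷ 1≤ps)
        (p≤n ∷ All.map (λ z<p → ≤-trans (<⇒≤ z<p) p≤n) (GapsAtLeast1⇒All<head gaps)))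

All-≤-sum : ∀ ps → All (_≤ sum ps) ps
All-≤-sum [] = []
All-≤-sum (p ∷ ps) = m≤m+n p (sum ps) ∷ All.map (λ z≤ → ≤-trans z≤ (m≤n+m (sum ps) p)) (All-≤-sum ps)

IsDiffPartition⇒∈-candidates : ∀ {a d n ps} → 1 ≤ a → 1 ≤ d → IsDiffPartition a d n ps →
  ps ∈ filter (isDiffPartition? a d n) (sublists (positives n))
IsDiffPartition⇒∈-candidates {a} {d} {n} {ps} 1≤a 1≤d valid@(sum≡n , a≤ps , gaps) =
  ∈-filter⁺ (isDiffPartition? a d n)
    (decreasing⇒∈-sublists-positives n ps (GapsAtLeast-mono 1≤d ps gaps) (All.map (≤-trans 1≤a) a≤ps)
      (subst (λ k → All (_≤ k) ps) sum≡n (All-≤-sum ps)))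
    valid

length-≤-injection : ∀ {A B : Set} (f : A → B) (xs : List A) (ys : List B) → Unique xs →
  (∀ {x} → x ∈ xs → f x ∈ ys) →
  (∀ {x y} → x ∈ xs → y ∈ xs → f x ≡ f y → x ≡ y) →
  length xs ≤ length ys
length-≤-injection f [] ys _ _ _ = z≤n
length-≤-injection f (x ∷ xs) ys (x∉xs ∷ xs!) maps inj with ∈-∃++ (maps (here refl))
... | ys₁ , ys₂ , refl = begin
  suc (length xs)                    ≤⟨ s≤s (length-≤-injection f xs (ys₁ ++ ys₂) xs! maps′ inj′) ⟩
  suc (length (ys₁ ++ ys₂))          ≡⟨ cong suc (length-++ ys₁) ⟩
  suc (length ys₁ + length ys₂)      ≡⟨ +-suc (length ys₁) (length ys₂) ⟨
  length ys₁ + length (f x ∷ ys₂)    ≡⟨ length-++ ys₁ ⟨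
  length (ys₁ ++ f x ∷ ys₂)          ∎
  where
  open ≤-Reasoning
  delete : ∀ {v} → v ∈ ys₁ ++ f x ∷ ys₂ → v ≢ f x → v ∈ ys₁ ++ ys₂
  delete v∈ v≢fx with ∈-++⁻ ys₁ v∈
  ... | inj₁ v∈ys₁ = ∈-++⁺ˡ v∈ys₁
  ... | inj₂ (here v≡fx) = contradiction v≡fx v≢fx
  ... | inj₂ (there v∈ys₂) = ∈-++⁺ʳ ys₁ v∈ys₂
  maps′ : ∀ {y} → y ∈ xs → f y ∈ ys₁ ++ ys₂
  maps′ y∈ = delete (maps (there y∈)) λ fy≡fx →
    All¬⇒¬Any x∉xs (subst (_∈ xs) (inj (there y∈) (here refl) fy≡fx) y∈)
  inj′ : ∀ {y z} → y ∈ xs → z ∈ xs → f y ≡ f z → y ≡ z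
  inj′ y∈ z∈ = inj (there y∈) (there z∈)

q-≤-injection : ∀ {a d n a′ d′ n′} → 1 ≤ a → 1 ≤ d → (f : List ℕ → List ℕ) →
  (∀ {l} → IsDiffPartition a′ d′ n′ l → IsDiffPartition a d n (f l)) →
  (∀ {l l′} → IsDiffPartition a′ d′ n′ l → IsDiffPartition a′ d′ n′ l′ → f l ≡ f l′ → l ≡ l′) →
  q a′ d′ n′ ≤ q a d n
q-≤-injection {a} {d} {n} {a′} {d′} {n′} 1≤a 1≤d f valid inj =
  length-≤-injection f (filter P? (sublists (positives n′))) _
    (Unique.filter⁺ P? (sublists-unique (positives-unique n′)))
    (IsDiffPartition⇒∈-candidates 1≤a 1≤d ∘ valid ∘ isDiffPartition)
    (λ l∈ l′∈ → inj (isDiffPartition l∈) (isDiffPartition l′∈))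
  where
  P? = isDiffPartition? a′ d′ n′
  isDiffPartition : ∀ {l} → l ∈ filter P? (sublists (positives n′)) → IsDiffPartition a′ d′ n′ l
  isDiffPartition = proj₂ ∘ ∈-filter⁻ P? {xs = sublists (positives n′)}

∣⇒∤∸ : ∀ {a r y} → 0 < r → r < a → r ≤ y → a ∣ y → a ∤ y ∸ r
∣⇒∤∸ {a} {r} {y} 0<r r<a r≤y a∣y a∣y∸r = <⇒≱ r<a (∣⇒≤ {{>-nonZero 0<r}} a∣r)
  where
  a∣r : a ∣ r
  a∣r = ∣m+n∣m⇒∣n (subst (a ∣_) (sym (m∸n+n≡m r≤y)) a∣y) a∣y∸r

-- 0 on the empty list is junk: partitions of a positive number are nonempty.
lastPart : List ℕ → ℕ
lastPart [] = 0
lastPart (x ∷ []) = x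
lastPart (_ ∷ y ∷ ys) = lastPart (y ∷ ys)

All⇒lastPart : ∀ {P : ℕ → Set} {x xs} → All P (x ∷ xs) → P (lastPart (x ∷ xs))
All⇒lastPart {xs = []} (px ∷ _) = px
All⇒lastPart {xs = y ∷ ys} (_ ∷ pys) = All⇒lastPart pys

module Rescaling (A d e m n r : ℕ) .{{_ : NonZero A}}
  (1≤d : 1 ≤ d) (d≤A*e : d ≤ A * e) (r<A : r < A) (n+r≡A*m : n + r ≡ A * m)
  (d+2A≤n : d + 2 * A ≤ n) where

  A≤A*x : ∀ {x} → 1 ≤ x → A ≤ A * x
  A≤A*x {x} 1≤x = subst (_≤ A * x) (*-identityʳ A) (*-monoʳ-≤ A 1≤x)

  r≤A*x : ∀ {x} → 1 ≤ x → r ≤ A * x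
  r≤A*x 1≤x = ≤-trans (<⇒≤ r<A) (A≤A*x 1≤x)

  1≤e : 1 ≤ e
  1≤e = n≢0⇒n>0 λ { refl → <⇒≱ 1≤d (≤-trans d≤A*e (≤-reflexive (*-zeroʳ A))) }

  2≤m : 2 ≤ m
  2≤m = *-cancelʳ-≤ 2 m A (begin
    2 * A      ≤⟨ m≤n+m (2 * A) d ⟩
    d + 2 * A  ≤⟨ d+2A≤n ⟩
    n          ≤⟨ m≤m+n n r ⟩
    n + r      ≡⟨ n+r≡A*m ⟩
    A * m      ≡⟨ *-comm A m ⟩
    m * A      ∎)
    where open ≤-Reasoning

  <2⇒≢m : ∀ {k} → k < 2 → k ≢ m
  <2⇒≢m k<2 refl = <⇒≱ k<2 2≤m

  s+r≡A*m⇒s≡n : ∀ {s} → s + r ≡ A * m → s ≡ n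
  s+r≡A*m⇒s≡n {s} s+r≡A*m = +-cancelʳ-≡ r s n (trans s+r≡A*m (sym n+r≡A*m))

  gap-scales : ∀ {x y} → e + y ≤ x → d + A * y ≤ A * x
  gap-scales {x} {y} e+y≤x = begin
    d + A * y      ≤⟨ +-monoˡ-≤ (A * y) d≤A*e ⟩
    A * e + A * y  ≡⟨ *-distribˡ-+ A e y ⟨
    A * (e + y)    ≤⟨ *-monoʳ-≤ A e+y≤x ⟩
    A * x          ∎
    where open ≤-Reasoning

  1≤lastPart : ∀ {l} → IsDiffPartition 1 e m l → 1 ≤ lastPart l
  1≤lastPart {[]} (sum≡m , _) = contradiction sum≡m (<2⇒≢m z<s)
  1≤lastPart {_ ∷ _} (_ , 1≤parts , _) = All⇒lastPart 1≤parts

  unlowerable : ∀ {L} → 1 ≤ L → ¬ (A + r ≤ A * L) → L ≡ 1 × 0 < r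
  unlowerable {suc zero} _ A+r≰A = refl , n≢0⇒n>0 λ { refl → A+r≰A (≤-reflexive (trans (+-identityʳ A) (sym (*-identityʳ A)))) }
  unlowerable {suc (suc L)} _ A+r≰A = contradiction A+r≤A*L A+r≰A
    where
    A+r≤A*L : A + r ≤ A * suc (suc L)
    A+r≤A*L = ≤-trans (+-monoʳ-≤ A (r≤A*x (s≤s z≤n))) (≤-reflexive (sym (*-suc A (suc L))))

  lowerLast : List ℕ → List ℕ
  lowerLast [] = []
  lowerLast (x ∷ []) = A * x ∸ r ∷ []
  lowerLast (x ∷ y ∷ ys) = A * x ∷ lowerLast (y ∷ ys)

  scaleInit : List ℕ → List ℕ
  scaleInit [] = []
  scaleInit (x ∷ []) = []
  scaleInit (x ∷ y ∷ ys) = A * x ∷ scaleInit (y ∷ ys)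

  absorbLast : List ℕ → List ℕ
  absorbLast (x ∷ y ∷ []) = n ∸ A ∷ A ∷ []
  absorbLast (x ∷ y ∷ z ∷ zs) = A * x + (A ∸ r) ∷ scaleInit (y ∷ z ∷ zs)
  absorbLast _ = []

  rescale : List ℕ → List ℕ
  rescale l with A + r ≤? A * lastPart l
  ... | yes _ = lowerLast l
  ... | no _ = absorbLast l

  lowerLast-sum : ∀ x xs → r ≤ A * lastPart (x ∷ xs) → sum (lowerLast (x ∷ xs)) + r ≡ A * sum (x ∷ xs)
  lowerLast-sum x [] r≤A*x = begin
    (A * x ∸ r + 0) + r  ≡⟨ cong (_+ r) (+-identityʳ (A * x ∸ r)) ⟩
    A * x ∸ r + r        ≡⟨ m∸n+n≡m r≤A*x ⟩
    A * x                ≡⟨ cong (A *_) (+-identityʳ x) ⟨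
    A * (x + 0)          ∎
    where open ≡-Reasoning
  lowerLast-sum x (y ∷ ys) r≤A*last = begin
    (A * x + sum (lowerLast (y ∷ ys))) + r  ≡⟨ +-assoc (A * x) _ r ⟩
    A * x + (sum (lowerLast (y ∷ ys)) + r)  ≡⟨ cong (A * x +_) (lowerLast-sum y ys r≤A*last) ⟩
    A * x + A * sum (y ∷ ys)                ≡⟨ *-distribˡ-+ A x (sum (y ∷ ys)) ⟨
    A * (x + sum (y ∷ ys))                  ∎
    where open ≡-Reasoning

  lowerLast-parts : ∀ x xs → All (1 ≤_) (x ∷ xs) → A + r ≤ A * lastPart (x ∷ xs) → All (A ≤_) (lowerLast (x ∷ xs))
  lowerLast-parts x [] _ A+r≤A*x = m+n≤o⇒m≤o∸n A A+r≤A*x ∷ []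
  lowerLast-parts x (y ∷ ys) (1≤x ∷ 1≤ys) A+r≤A*last = A≤A*x 1≤x ∷ lowerLast-parts y ys 1≤ys A+r≤A*last

  lowerLast-gaps : ∀ x xs → GapsAtLeast e (x ∷ xs) → GapsAtLeast d (lowerLast (x ∷ xs))
  lowerLast-gaps x [] _ = tt
  lowerLast-gaps x (y ∷ []) (gap , _) = ≤-trans (+-monoʳ-≤ d (m∸n≤m (A * y) r)) (gap-scales gap) , tt
  lowerLast-gaps x (y ∷ z ∷ zs) (gap , gaps) = gap-scales gap , lowerLast-gaps y (z ∷ zs) gaps

  lowerLast-valid : ∀ {l} → IsDiffPartition 1 e m l → A + r ≤ A * lastPart l → IsDiffPartition A d n (lowerLast l)
  lowerLast-valid {[]} (sum≡m , _) _ = contradiction sum≡m (<2⇒≢m z<s)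
  lowerLast-valid {x ∷ xs} (sum≡m , 1≤parts , gaps) A+r≤A*last =
    s+r≡A*m⇒s≡n (trans (lowerLast-sum x xs (≤-trans (m≤n+m r A) A+r≤A*last)) (cong (A *_) sum≡m)) ,
    lowerLast-parts x xs 1≤parts A+r≤A*last ,
    lowerLast-gaps x xs gaps

  scaleInit-sum : ∀ x xs → sum (scaleInit (x ∷ xs)) + A * lastPart (x ∷ xs) ≡ A * sum (x ∷ xs)
  scaleInit-sum x [] = cong (A *_) (sym (+-identityʳ x))
  scaleInit-sum x (y ∷ ys) = begin
    (A * x + sum (scaleInit (y ∷ ys))) + A * lastPart (y ∷ ys)  ≡⟨ +-assoc (A * x) _ _ ⟩
    A * x + (sum (scaleInit (y ∷ ys)) + A * lastPart (y ∷ ys))  ≡⟨ cong (A * x +_) (scaleInit-sum y ys) ⟩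
    A * x + A * sum (y ∷ ys)                                    ≡⟨ *-distribˡ-+ A x (sum (y ∷ ys)) ⟨
    A * (x + sum (y ∷ ys))                                      ∎
    where open ≡-Reasoning

  scaleInit-parts : ∀ xs → All (1 ≤_) xs → All (A ≤_) (scaleInit xs)
  scaleInit-parts [] _ = []
  scaleInit-parts (x ∷ []) _ = []
  scaleInit-parts (x ∷ y ∷ ys) (1≤x ∷ 1≤ys) = A≤A*x 1≤x ∷ scaleInit-parts (y ∷ ys) 1≤ys

  scaleInit-gaps : ∀ xs → GapsAtLeast e xs → GapsAtLeast d (scaleInit xs)
  scaleInit-gaps [] _ = tt
  scaleInit-gaps (x ∷ []) _ = tt
  scaleInit-gaps (x ∷ y ∷ []) _ = tt
  scaleInit-gaps (x ∷ y ∷ z ∷ zs) (gap , gaps) = gap-scales gap , scaleInit-gaps (y ∷ z ∷ zs) gaps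

  absorbLast-valid : ∀ {l} → IsDiffPartition 1 e m l → lastPart l ≡ 1 → IsDiffPartition A d n (absorbLast l)
  absorbLast-valid {[]} (sum≡m , _) _ = contradiction sum≡m (<2⇒≢m z<s)
  absorbLast-valid {x ∷ []} (sum≡m , _) refl = contradiction sum≡m (<2⇒≢m ≤-refl)
  absorbLast-valid {x ∷ y ∷ []} _ _ =
    trans (cong (n ∸ A +_) (+-identityʳ A)) (m∸n+n≡m (≤-trans (m≤m+n A A) 2A≤n)) ,
    (m+n≤o⇒m≤o∸n A 2A≤n ∷ ≤-refl ∷ []) ,
    (m+n≤o⇒m≤o∸n (d + A) d+A+A≤n , tt)
    where
    d+A+A≤n : d + A + A ≤ n
    d+A+A≤n = subst (_≤ n) (trans (cong (λ t → d + (A + t)) (+-identityʳ A)) (sym (+-assoc d A A))) d+2A≤n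
    2A≤n : A + A ≤ n
    2A≤n = ≤-trans (≤-trans (m≤n+m (A + A) d) (≤-reflexive (sym (+-assoc d A A)))) d+A+A≤n
  absorbLast-valid {x ∷ y ∷ z ∷ zs} (sum≡m , 1≤x ∷ 1≤ys , gap , gaps) last≡1 =
    s+r≡A*m⇒s≡n total ,
    (≤-trans (A≤A*x 1≤x) (m≤m+n (A * x) (A ∸ r)) ∷ scaleInit-parts (y ∷ z ∷ zs) 1≤ys) ,
    (≤-trans (gap-scales gap) (m≤m+n (A * x) (A ∸ r)) , scaleInit-gaps (y ∷ z ∷ zs) gaps)
    where
    S = sum (scaleInit (y ∷ z ∷ zs))
    T = sum (y ∷ z ∷ zs)
    total : (A * x + (A ∸ r) + S) + r ≡ A * m
    total = begin
      (A * x + (A ∸ r) + S) + r                ≡⟨ solve 4 (λ P t Q u → ((P :+ t) :+ Q) :+ u := P :+ (Q :+ (t :+ u))) refl (A * x) (A ∸ r) S r ⟩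
      A * x + (S + (A ∸ r + r))                ≡⟨ cong (λ t → A * x + (S + t)) (m∸n+n≡m (<⇒≤ r<A)) ⟩
      A * x + (S + A)                          ≡⟨ cong (λ t → A * x + (S + t)) (trans (sym (*-identityʳ A)) (cong (A *_) (sym last≡1))) ⟩
      A * x + (S + A * lastPart (y ∷ z ∷ zs))  ≡⟨ cong (A * x +_) (scaleInit-sum y (z ∷ zs)) ⟩
      A * x + A * T                            ≡⟨ *-distribˡ-+ A x T ⟨
      A * (x + T)                              ≡⟨ cong (A *_) sum≡m ⟩
      A * m                                    ∎
      where open ≡-Reasoning

  rescale-valid : ∀ {l} → IsDiffPartition 1 e m l → IsDiffPartition A d n (rescale l)
  rescale-valid {l} valid with A + r ≤? A * lastPart l
  ... | yes lowerable = lowerLast-valid valid lowerable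
  ... | no ¬lowerable = absorbLast-valid valid (proj₁ (unlowerable (1≤lastPart valid) ¬lowerable))

  lowerLast-nonempty : ∀ x xs → lowerLast (x ∷ xs) ≢ []
  lowerLast-nonempty x [] ()
  lowerLast-nonempty x (y ∷ ys) ()

  lowerLast-injective : ∀ {xs ys} → All (1 ≤_) xs → All (1 ≤_) ys → lowerLast xs ≡ lowerLast ys → xs ≡ ys
  lowerLast-injective {[]} {[]} _ _ _ = refl
  lowerLast-injective {[]} {y ∷ ys} _ _ eq = contradiction (sym eq) (lowerLast-nonempty y ys)
  lowerLast-injective {x ∷ xs} {[]} _ _ eq = contradiction eq (lowerLast-nonempty x xs)
  lowerLast-injective {x ∷ []} {y ∷ []} (1≤x ∷ _) (1≤y ∷ _) eq =
    cong (_∷ []) (*-cancelˡ-≡ x y A (∸-cancelʳ-≡ (r≤A*x 1≤x) (r≤A*x 1≤y) (∷-injectiveˡ eq)))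
  lowerLast-injective {x ∷ []} {y ∷ z ∷ zs} _ _ eq = contradiction (sym (∷-injectiveʳ eq)) (lowerLast-nonempty z zs)
  lowerLast-injective {x ∷ z ∷ zs} {y ∷ []} _ _ eq = contradiction (∷-injectiveʳ eq) (lowerLast-nonempty z zs)
  lowerLast-injective {x ∷ x′ ∷ xs} {y ∷ y′ ∷ ys} (_ ∷ 1≤xs) (_ ∷ 1≤ys) eq =
    cong₂ _∷_ (*-cancelˡ-≡ x y A (∷-injectiveˡ eq)) (lowerLast-injective 1≤xs 1≤ys (∷-injectiveʳ eq))

  scaleInit-injective : ∀ {x xs y ys} → lastPart (x ∷ xs) ≡ lastPart (y ∷ ys) →
    scaleInit (x ∷ xs) ≡ scaleInit (y ∷ ys) → x ∷ xs ≡ y ∷ ys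
  scaleInit-injective {xs = []} {ys = []} x≡y _ = cong (_∷ []) x≡y
  scaleInit-injective {xs = []} {ys = _ ∷ _} _ ()
  scaleInit-injective {xs = _ ∷ _} {ys = []} _ ()
  scaleInit-injective {x} {x′ ∷ xs} {y} {y′ ∷ ys} last≡ eq =
    cong₂ _∷_ (*-cancelˡ-≡ x y A (∷-injectiveˡ eq)) (scaleInit-injective last≡ (∷-injectiveʳ eq))

  [A]≢scaleInit : ∀ {x y z zs} → IsDiffPartition 1 e m (x ∷ y ∷ z ∷ zs) → lastPart (z ∷ zs) ≡ 1 →
    A ∷ [] ≢ scaleInit (y ∷ z ∷ zs)
  [A]≢scaleInit {zs = _ ∷ _} _ _ ()
  [A]≢scaleInit {y = y} {zs = []} (_ , _ , _ , 1+e≤y , _) refl eq =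
    <⇒≱ (+-monoˡ-≤ 1 1≤e) (subst (e + 1 ≤_) y≡1 1+e≤y)
    where
    y≡1 : y ≡ 1
    y≡1 = *-cancelˡ-≡ y 1 A (trans (sym (∷-injectiveˡ eq)) (sym (*-identityʳ A)))

  absorbLast-injective : ∀ {l l′} → IsDiffPartition 1 e m l → IsDiffPartition 1 e m l′ →
    lastPart l ≡ 1 → lastPart l′ ≡ 1 → absorbLast l ≡ absorbLast l′ → l ≡ l′
  absorbLast-injective {[]} (sum≡m , _) _ _ _ _ = contradiction sum≡m (<2⇒≢m z<s)
  absorbLast-injective {x ∷ []} (sum≡m , _) _ refl _ _ = contradiction sum≡m (<2⇒≢m ≤-refl)
  absorbLast-injective {_} {[]} _ (sum≡m , _) _ _ _ = contradiction sum≡m (<2⇒≢m z<s)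
  absorbLast-injective {_} {x ∷ []} _ (sum≡m , _) _ refl _ = contradiction sum≡m (<2⇒≢m ≤-refl)
  absorbLast-injective {x ∷ _ ∷ []} {x′ ∷ _ ∷ []} (sum≡m , _) (sum′≡m , _) refl refl _ =
    cong (λ t → t ∷ 1 ∷ []) (+-cancelʳ-≡ (1 + 0) x x′ (trans sum≡m (sym sum′≡m)))
  absorbLast-injective {_ ∷ _ ∷ []} {_ ∷ _ ∷ _ ∷ _} _ valid′ _ last′≡1 eq =
    contradiction (∷-injectiveʳ eq) ([A]≢scaleInit valid′ last′≡1)
  absorbLast-injective {_ ∷ _ ∷ _ ∷ _} {_ ∷ _ ∷ []} valid _ last≡1 _ eq =
    contradiction (sym (∷-injectiveʳ eq)) ([A]≢scaleInit valid last≡1)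
  absorbLast-injective {x ∷ _ ∷ _ ∷ _} {x′ ∷ _ ∷ _ ∷ _} _ _ last≡1 last′≡1 eq =
    cong₂ _∷_ (*-cancelˡ-≡ x x′ A (+-cancelʳ-≡ (A ∸ r) (A * x) (A * x′) (∷-injectiveˡ eq)))
      (scaleInit-injective (trans last≡1 (sym last′≡1)) (∷-injectiveʳ eq))

  lastPart-lowerLast : ∀ x xs → lastPart (lowerLast (x ∷ xs)) ≡ A * lastPart (x ∷ xs) ∸ r
  lastPart-lowerLast x [] = refl
  lastPart-lowerLast x (y ∷ []) = refl
  lastPart-lowerLast x (y ∷ z ∷ zs) = lastPart-lowerLast y (z ∷ zs)

  A∣lastPart-scaleInit : ∀ xs → A ∣ lastPart (scaleInit xs)
  A∣lastPart-scaleInit [] = A ∣0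
  A∣lastPart-scaleInit (x ∷ []) = A ∣0
  A∣lastPart-scaleInit (x ∷ y ∷ []) = m∣m*n x
  A∣lastPart-scaleInit (x ∷ y ∷ z ∷ zs) = A∣lastPart-scaleInit (y ∷ z ∷ zs)

  A∣lastPart-absorbLast : ∀ l → A ∣ lastPart (absorbLast l)
  A∣lastPart-absorbLast [] = A ∣0
  A∣lastPart-absorbLast (x ∷ []) = A ∣0
  A∣lastPart-absorbLast (x ∷ y ∷ []) = ∣-refl
  A∣lastPart-absorbLast (x ∷ y ∷ z ∷ zs) = A∣lastPart-scaleInit (y ∷ z ∷ zs)

  lowerLast≢absorbLast : ∀ {l l′} → IsDiffPartition 1 e m l → 0 < r → lowerLast l ≢ absorbLast l′
  lowerLast≢absorbLast {[]} (sum≡m , _) _ _ = contradiction sum≡m (<2⇒≢m z<s)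
  lowerLast≢absorbLast {x ∷ xs} {l′} (_ , 1≤parts , _) 0<r eq =
    ∣⇒∤∸ 0<r r<A (r≤A*x (All⇒lastPart 1≤parts)) (m∣m*n _)
      (subst (A ∣_) (trans (cong lastPart (sym eq)) (lastPart-lowerLast x xs)) (A∣lastPart-absorbLast l′))

  rescale-injective : ∀ {l l′} → IsDiffPartition 1 e m l → IsDiffPartition 1 e m l′ → rescale l ≡ rescale l′ → l ≡ l′
  rescale-injective {l} {l′} valid valid′ eq
    with A + r ≤? A * lastPart l | A + r ≤? A * lastPart l′
  ... | yes _ | yes _ = lowerLast-injective (proj₁ (proj₂ valid)) (proj₁ (proj₂ valid′)) eq
  ... | yes _ | no ¬lowerable′ =
    contradiction eq (lowerLast≢absorbLast valid (proj₂ (unlowerable (1≤lastPart valid′) ¬lowerable′)))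
  ... | no ¬lowerable | yes _ =
    contradiction (sym eq) (lowerLast≢absorbLast valid′ (proj₂ (unlowerable (1≤lastPart valid) ¬lowerable)))
  ... | no ¬lowerable | no ¬lowerable′ =
    absorbLast-injective valid valid′
      (proj₁ (unlowerable (1≤lastPart valid) ¬lowerable)) (proj₁ (unlowerable (1≤lastPart valid′) ¬lowerable′)) eq

module _ (x k : ℕ) where
  private
    N = x + suc k ∸ 1
    c = N / suc k

    N≡x+k : N ≡ x + k
    N≡x+k = cong (_∸ 1) (+-suc x k)

  ≤-*⌈/⌉ : x ≤ suc k * ⌈ x / suc k ⌉
  ≤-*⌈/⌉ = +-cancelʳ-≤ k x (suc k * c) (begin
    x + k                  ≡⟨ N≡x+k ⟨
    N                      ≡⟨ m≡m%n+[m/n]*n N (suc k) ⟩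
    N % suc k + c * suc k  ≤⟨ +-monoˡ-≤ (c * suc k) (s≤s⁻¹ (m%n<n N (suc k))) ⟩
    k + c * suc k          ≡⟨ +-comm k (c * suc k) ⟩
    c * suc k + k          ≡⟨ cong (_+ k) (*-comm c (suc k)) ⟩
    suc k * c + k          ∎)
    where open ≤-Reasoning

  *⌈/⌉<+ : suc k * ⌈ x / suc k ⌉ < x + suc k
  *⌈/⌉<+ = begin-strict
    suc k * c  ≡⟨ *-comm (suc k) c ⟩
    c * suc k  ≤⟨ m/n*n≤m N (suc k) ⟩
    N          ≡⟨ N≡x+k ⟩
    x + k      <⟨ +-monoʳ-< x ≤-refl ⟩
    x + suc k  ∎
    where open ≤-Reasoning

lemma2p4 : (a d n : ℕ) .{{_ : NonZero a}} → 1 ≤ d → d + 2 * a ≤ n →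
    q a d n ≥ q 1 ⌈ d / a ⌉ ⌈ n / a ⌉
lemma2p4 a@(suc k) d n 1≤d d+2a≤n =
  q-≤-injection (>-nonZero⁻¹ a) 1≤d rescale rescale-valid rescale-injective
  where
  m = ⌈ n / a ⌉
  r = a * m ∸ n
  r<a : r < a
  r<a = m<n+o⇒m∸n<o (a * m) n (*⌈/⌉<+ n k)
  open Rescaling a d ⌈ d / a ⌉ m n r 1≤d (≤-*⌈/⌉ d k) r<a (m+[n∸m]≡n (≤-*⌈/⌉ n k)) d+2a≤n
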